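{- If $G$ is a connected graph with $n(G)\ge 2$, then $\chi_{\rho}(M(G))\ge \chi_{\rho}(G) + 2$, with equality if $G$ is complete.
   Context: All graphs are finite and simple; $n(G)$ is the number of vertices of $G$. For a positive integer $i$, an $i$-packing in $G$ is a set $W\subseteq V(G)$ such that any two distinct vertices of $W$ are at distance greater than $i$ in $G$. The packing chromatic number $\chi_{\rho}(G)$ is the smallest integer $k$ such that $V(G)$ can be partitioned into sets $V_1,\dots,V_k$ with $V_i$ an $i$-packing for each $i\in\{1,\dots,k\}$. The Mycielskian $M(G)$ of $G$ is the graph with vertex set $V(G)\cup V'\cup\{w\}$, where $V'=\{x' : x\in V(G)\}$ is a set of new vertices and $w$ is a further new vertex, and edge set $E(G)\cup\{xy' : xy\in E(G)\}\cup\{wx' : x'\in V'\}$. -}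

module Defs where

open import Data.Nat using (ℕ; zero; suc; _+_)
open import Data.Fin using (Fin; toℕ; splitAt)
open import Data.Sum using (_⊎_; inj₁; inj₂)
open import Data.Product using (Σ; ∃; _×_; _,_)
open import Data.Empty using (⊥)
open import Data.Unit using (⊤)
open import Relation.Nullary using (¬_)
open import Relation.Binary.PropositionalEquality using (_≡_; _≢_)

record Graph : Set₁ where
  field
    n     : ℕ
    Adj   : Fin n → Fin n → Set
    sym   : ∀ {u v} → Adj u v → Adj v u
    irrefl : ∀ {u} → ¬ Adj u u

open Graph public

-- Within G i u v : there is a walk from u to v of length at most i,
-- i.e. d_G(u,v) ≤ i.
data Within (G : Graph) : ℕ → Fin (n G) → Fin (n G) → Set where
  here : ∀ {i u} → Within G i u u
  step : ∀ {i u w v} → Adj G u w → Within G i w v → Within G (suc i) u v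

Connected : Graph → Set
Connected G = ∀ u v → ∃ λ i → Within G i u v

Complete : Graph → Set
Complete G = ∀ u v → u ≢ v → Adj G u v

-- A packing k-colouring: c assigns to each vertex a class in {1,…,k}
-- (class j+1 is encoded by j : Fin k); the class V_{j+1} must be a
-- (j+1)-packing: distinct vertices of it are at distance > j+1.
IsPackingColoring : (G : Graph) (k : ℕ) → (Fin (n G) → Fin k) → Set
IsPackingColoring G k c =
  ∀ u v → u ≢ v → c u ≡ c v → ¬ Within G (suc (toℕ (c u))) u v

HasPackingColoring : Graph → ℕ → Set
HasPackingColoring G k = Σ (Fin (n G) → Fin k) (IsPackingColoring G k)

IsPackingChromaticNumber : Graph → ℕ → Set
IsPackingChromaticNumber G k =
  HasPackingColoring G k × (∀ m → HasPackingColoring G m → k Data.Nat.≤ m)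

-- Vertices of the Mycielskian: originals x, copies x', and the hub w.
data MV (m : ℕ) : Set where
  orig : Fin m → MV m
  copy : Fin m → MV m
  hub  : MV m

-- Encoding of V(M(G)) as Fin (1 + (n + n)): 0 is w, then the
-- originals, then the copies.
decode : ∀ {m} → Fin (suc (m + m)) → MV m
decode Fin.zero = hub
decode {m} (Fin.suc x) with splitAt m x
... | inj₁ a = orig a
... | inj₂ b = copy b

MAdj' : (G : Graph) → MV (n G) → MV (n G) → Set
MAdj' G (orig x) (orig y) = Adj G x y
MAdj' G (orig x) (copy y) = Adj G x y
MAdj' G (copy x) (orig y) = Adj G x y
MAdj' G (copy x) (copy y) = ⊥
MAdj' G (copy x) hub      = ⊤
MAdj' G hub      (copy y) = ⊤
MAdj' G (orig x) hub      = ⊥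
MAdj' G hub      (orig y) = ⊥
MAdj' G hub      hub      = ⊥

MAdj'-sym : (G : Graph) → ∀ a b → MAdj' G a b → MAdj' G b a
MAdj'-sym G (orig x) (orig y) p = sym G p
MAdj'-sym G (orig x) (copy y) p = sym G p
MAdj'-sym G (copy x) (orig y) p = sym G p
MAdj'-sym G (copy x) hub p = p
MAdj'-sym G hub (copy y) p = p

MAdj'-irrefl : (G : Graph) → ∀ a → ¬ MAdj' G a a
MAdj'-irrefl G (orig x) p = irrefl G p
MAdj'-irrefl G (copy x) ()
MAdj'-irrefl G hub ()

Mycielskian : Graph → Graph
Mycielskian G = record
  { n      = suc (n G + n G)
  ; Adj    = λ a b → MAdj' G (decode a) (decode b)
  ; sym    = λ {a} {b} → MAdj'-sym G (decode a) (decode b)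
  ; irrefl = λ {a} → MAdj'-irrefl G (decode a)
  }

module Submission where

-- As G is connected with two vertices, every vertex of G has a
-- neighbour.  Distances in M(G) then give: w is within 1 of every copy and
-- within 2 of every original, copies are pairwise within 2, every copy is
-- within 3 of every original, and x' is within 2 of x.  Consequently, in a
-- packing colouring c of M(G), the colour of w (unless it is 1) and every
-- copy colour ≥ 3 never occur on originals, and two copies sharing a colour
-- have colour 1.  A case analysis on c(w) and the copy colours produces a
-- packing colouring of G (the restriction of c, or in one case the
-- restriction with colours 1 and 2 merged) leaving two colours unused;
-- deleting those two colours shows χ_ρ(G) ≤ χ_ρ(M(G)) − 2.
--
-- Upper bound for complete G: colour all copies 1, w by 2, and each
-- original x by 2 + (the colour of x in an optimal packing colouring of G).

open import Defs
open import Data.Nat using (ℕ; zero; suc; _+_; _≤_; z≤n; s≤s; _≤?_)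
open import Data.Nat.Properties using (n≤1+n; ≤-refl; ≤-antisym; +-comm; +-monoˡ-≤; module ≤-Reasoning)
open import Data.Fin as F using (Fin; toℕ; splitAt; _↑ˡ_; _↑ʳ_; punchOut; join)
open import Data.Fin.Properties
  using (splitAt-↑ˡ; splitAt-↑ʳ; join-splitAt; punchOut-injective; suc-injective; any?; _≟_)
open import Data.Sum using (_⊎_; inj₁; inj₂)
open import Data.Product using (Σ; ∃; _×_; _,_; proj₁; proj₂)
open import Data.Empty using (⊥; ⊥-elim)
open import Data.Unit using (tt)
open import Function using (_∘_)
open import Relation.Nullary using (¬_; yes; no)
open import Relation.Nullary.Decidable using (¬?; _×-dec_)
open import Relation.Binary.PropositionalEquality
  using (_≡_; _≢_; refl; trans; cong; subst; subst₂)
  renaming (sym to ≡-sym)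

Within-mono : ∀ {G : Graph} {i j u v} → i ≤ j → Within G i u v → Within G j u v
Within-mono i≤j here = here
Within-mono (s≤s i≤j) (step a w) = step a (Within-mono i≤j w)

Within-1⇒Adj : ∀ {G : Graph} {u v} → u ≢ v → Within G 1 u v → Adj G u v
Within-1⇒Adj u≢v here = ⊥-elim (u≢v refl)
Within-1⇒Adj u≢v (step a here) = a

Within⇒neighbour : ∀ {G : Graph} {i x y} → x ≢ y → Within G i x y → ∃ (Adj G x)
Within⇒neighbour x≢y here = ⊥-elim (x≢y refl)
Within⇒neighbour x≢y (step a _) = _ , a

noIsolatedVertex : ∀ {G : Graph} → Connected G → {p q : Fin (n G)} → p ≢ q →
                   ∀ x → ∃ (Adj G x)
noIsolatedVertex conn {p} {q} p≢q x with x ≟ p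
... | yes refl = Within⇒neighbour p≢q (proj₂ (conn x q))
... | no x≢p   = Within⇒neighbour x≢p (proj₂ (conn x p))

twoDistinct : ∀ {N} → 2 ≤ N → Σ (Fin N) λ p → Σ (Fin N) λ q → p ≢ q
twoDistinct {suc (suc N)} (s≤s (s≤s z≤n)) = F.zero , F.suc F.zero , λ ()

packing-apart : ∀ {G : Graph} {k} {f : Fin (n G) → Fin k} → IsPackingColoring G k f →
  ∀ {u v a} → u ≢ v → f u ≡ a → f v ≡ a → ¬ Within G (suc (toℕ a)) u v
packing-apart f-packing u≢v refl fv = f-packing _ _ u≢v (≡-sym fv)

Unused : ∀ {A : Set} {k} → (A → Fin k) → Fin k → Set
Unused f a = ∀ x → a ≢ f x

toℕ-punchOut-≤ : ∀ {m} {i j : Fin (suc m)} (i≢j : i ≢ j) → toℕ (punchOut i≢j) ≤ toℕ j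
toℕ-punchOut-≤ {_}     {F.zero}  {F.zero}  i≢j = ⊥-elim (i≢j refl)
toℕ-punchOut-≤ {_}     {F.zero}  {F.suc j} i≢j = n≤1+n (toℕ j)
toℕ-punchOut-≤ {suc _} {F.suc i} {F.zero}  i≢j = z≤n
toℕ-punchOut-≤ {suc _} {F.suc i} {F.suc j} i≢j = s≤s (toℕ-punchOut-≤ {i = i} {j = j} _)

module _ (G : Graph) {m} (f : Fin (n G) → Fin (suc m))
         (f-packing : IsPackingColoring G (suc m) f) {a : Fin (suc m)} (a-unused : Unused f a) where

  deleteColour : Fin (n G) → Fin m
  deleteColour x = punchOut (a-unused x)

  -- Deleting an unused colour keeps a packing colouring: colour classes
  -- stay the same while their required distances can only decrease.
  deleteColour-packing : IsPackingColoring G m deleteColour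
  deleteColour-packing u v u≢v same walk =
    f-packing u v u≢v (punchOut-injective (a-unused u) (a-unused v) same)
      (Within-mono (s≤s (toℕ-punchOut-≤ (a-unused u))) walk)

  deleteColour-unused : ∀ {b} (a≢b : a ≢ b) → Unused f b → Unused deleteColour (punchOut a≢b)
  deleteColour-unused a≢b b-unused x same = b-unused x (punchOut-injective a≢b (a-unused x) same)

record SpareColouring (G : Graph) (k : ℕ) : Set where
  constructor spareColouring
  field
    colour   : Fin (n G) → Fin k
    packing  : IsPackingColoring G k colour
    spare₁   : Fin k
    spare₂   : Fin k
    distinct : spare₁ ≢ spare₂
    unused₁  : Unused colour spare₁
    unused₂  : Unused colour spare₂

deleteSpareColours : ∀ {G m} → SpareColouring G (suc (suc m)) → HasPackingColoring G m
deleteSpareColours {G} (spareColouring f f-packing a b a≢b a-unused b-unused) =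
  deleteColour G f₁ (deleteColour-packing G f f-packing a-unused) b₁-unused ,
  deleteColour-packing G f₁ (deleteColour-packing G f f-packing a-unused) b₁-unused
  where
  f₁ = deleteColour G f f-packing a-unused
  b₁-unused = deleteColour-unused G f f-packing a-unused a≢b b-unused

mergeOneTwo : ∀ {k} → Fin (suc (suc k)) → Fin (suc (suc k))
mergeOneTwo (F.suc F.zero) = F.zero
mergeOneTwo a              = a

module _ (G : Graph) {k} (f : Fin (n G) → Fin (suc (suc k))) where

  -- If no vertex of colour 1 is adjacent to one of colour 2, the union of
  -- the two classes is a 1-packing, so merging them keeps a packing colouring.
  mergeOneTwo-packing : IsPackingColoring G (suc (suc k)) f →
    (∀ u v → f u ≡ F.zero → f v ≡ F.suc F.zero → ¬ Adj G u v) →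
    IsPackingColoring G (suc (suc k)) (mergeOneTwo ∘ f)
  mergeOneTwo-packing f-packing one-two-apart u v u≢v same walk
    with f u in fu | f v in fv
  ... | F.zero       | F.zero       = packing-apart f-packing u≢v fu fv walk
  ... | F.zero       | F.suc F.zero = one-two-apart u v fu fv (Within-1⇒Adj u≢v walk)
  ... | F.suc F.zero | F.zero       = one-two-apart v u fv fu (Graph.sym G (Within-1⇒Adj u≢v walk))
  ... | F.suc F.zero | F.suc F.zero = packing-apart f-packing u≢v fu fv (Within-mono (s≤s z≤n) walk)
  ... | F.suc (F.suc i) | F.suc (F.suc j) = packing-apart f-packing u≢v fu (trans fv (≡-sym same)) walk
  mergeOneTwo-packing _ _ _ _ _ () _ | F.zero       | F.suc (F.suc _)
  mergeOneTwo-packing _ _ _ _ _ () _ | F.suc F.zero | F.suc (F.suc _)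
  mergeOneTwo-packing _ _ _ _ _ () _ | F.suc (F.suc _) | F.zero
  mergeOneTwo-packing _ _ _ _ _ () _ | F.suc (F.suc _) | F.suc F.zero

  mergeOneTwo-unused-two : Unused (mergeOneTwo ∘ f) (F.suc F.zero)
  mergeOneTwo-unused-two x with f x
  ... | F.zero          = λ ()
  ... | F.suc F.zero    = λ ()
  ... | F.suc (F.suc _) = λ ()

  mergeOneTwo-unused : ∀ {a} → 2 ≤ toℕ a → Unused f a → Unused (mergeOneTwo ∘ f) a
  mergeOneTwo-unused {F.zero}          () _ _
  mergeOneTwo-unused {F.suc F.zero}    (s≤s ()) _ _
  mergeOneTwo-unused {F.suc (F.suc _)} _ a-unused x with f x in fx
  ... | F.zero          = λ ()
  ... | F.suc F.zero    = λ ()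
  ... | F.suc (F.suc _) = λ a≡ → a-unused x (trans a≡ (≡-sym fx))

-- Inverse of the vertex encoding 'decode' of M(G); through it the
-- distances in M(G) are computed on the readable vertex names.
encode : ∀ {m} → MV m → Fin (suc (m + m))
encode hub          = F.zero
encode {m} (orig x) = F.suc (x ↑ˡ m)
encode {m} (copy y) = F.suc (m ↑ʳ y)

decode-encode : ∀ {m} (v : MV m) → decode (encode v) ≡ v
decode-encode hub = refl
decode-encode {m} (orig x) rewrite splitAt-↑ˡ m x m = refl
decode-encode {m} (copy y) rewrite splitAt-↑ʳ m m y = refl

encode-decode : ∀ {m} (a : Fin (suc (m + m))) → encode {m} (decode {m} a) ≡ a
encode-decode {m} F.zero = refl
encode-decode {m} (F.suc x) with splitAt m x in eq
... | inj₁ _ = cong F.suc (trans (cong (join m m) (≡-sym eq)) (join-splitAt m m x))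
... | inj₂ _ = cong F.suc (trans (cong (join m m) (≡-sym eq)) (join-splitAt m m x))

encode-injective : ∀ {m} {u v : MV m} → encode u ≡ encode v → u ≡ v
encode-injective {m} {u} {v} e =
  trans (≡-sym (decode-encode u)) (trans (cong (decode {m}) e) (decode-encode v))

decode-injective : ∀ {m} {a b : Fin (suc (m + m))} → decode {m} a ≡ decode {m} b → a ≡ b
decode-injective {m} {a} {b} e =
  trans (≡-sym (encode-decode {m} a)) (trans (cong (encode {m}) e) (encode-decode {m} b))

orig-injective : ∀ {m} {x y : Fin m} → orig x ≡ orig y → x ≡ y
orig-injective refl = refl

copy-injective : ∀ {m} {x y : Fin m} → copy x ≡ copy y → x ≡ y
copy-injective refl = refl

module MycielskianDistances (G : Graph) (nb : ∀ x → ∃ (Adj G x)) where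

  M : Graph
  M = Mycielskian G

  E : MV (n G) → Fin (n M)
  E = encode

  edge : ∀ u v → MAdj' G u v → Adj M (E u) (E v)
  edge u v = subst₂ (MAdj' G) (≡-sym (decode-encode u)) (≡-sym (decode-encode v))

  orig-orig : ∀ {i x y} → Within G i x y → Within M i (E (orig x)) (E (orig y))
  orig-orig here = here
  orig-orig (step {w = z} a walk) = step {w = E (orig z)} (edge (orig _) (orig z) a) (orig-orig walk)

  orig-copy : ∀ x z → Adj G x z → Within M 1 (E (orig x)) (E (copy z))
  orig-copy x z a = step (edge (orig x) (copy z) a) here

  hub-copy : ∀ x → Within M 1 (E hub) (E (copy x))
  hub-copy x = step (edge hub (copy x) tt) here

  -- w – z' – x for a neighbour z of x.
  hub-orig : ∀ x → Within M 2 (E hub) (E (orig x))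
  hub-orig x = step {w = E (copy z)} (edge hub (copy z) tt)
                (step (edge (copy z) (orig x) (Graph.sym G z~x)) here)
    where z = proj₁ (nb x); z~x = proj₂ (nb x)

  copy-copy : ∀ x y → Within M 2 (E (copy x)) (E (copy y))
  copy-copy x y = step {w = E hub} (edge (copy x) hub tt) (hub-copy y)

  copy-orig : ∀ x y → Within M 3 (E (copy x)) (E (orig y))
  copy-orig x y = step {w = E hub} (edge (copy x) hub tt) (hub-orig y)

  -- y' – z – y for a neighbour z of y.
  copy-ownOrig : ∀ y → Within M 2 (E (copy y)) (E (orig y))
  copy-ownOrig y = step {w = E (orig z)} (edge (copy y) (orig z) y~z)
                    (step (edge (orig z) (orig y) (Graph.sym G y~z)) here)
    where z = proj₁ (nb y); y~z = proj₂ (nb y)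

  -- M(G) has the edge w p', so every packing colouring uses two colours.
  twoColoursNeeded : ∀ {k'} (p : Fin (n G)) → HasPackingColoring M k' → 2 ≤ k'
  twoColoursNeeded {zero} p (c , _) with c (E hub)
  ... | ()
  twoColoursNeeded {suc zero} p (c , c-packing) with c (E hub) in hub-colour | c (E (copy p)) in p'-colour
  ... | F.zero | F.zero = ⊥-elim (packing-apart c-packing (λ ()) hub-colour p'-colour (hub-copy p))
  twoColoursNeeded {suc (suc _)} p _ = s≤s (s≤s z≤n)

oneOrMore : ∀ {k} (a : Fin (suc k)) → a ≡ F.zero ⊎ 1 ≤ toℕ a
oneOrMore F.zero    = inj₁ refl
oneOrMore (F.suc a) = inj₂ (s≤s z≤n)

colourCases : ∀ {K} (a : Fin (suc (suc K))) → a ≡ F.zero ⊎ a ≡ F.suc F.zero ⊎ 2 ≤ toℕ a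
colourCases F.zero                = inj₁ refl
colourCases (F.suc F.zero)        = inj₂ (inj₁ refl)
colourCases (F.suc (F.suc a))     = inj₂ (inj₂ (s≤s (s≤s z≤n)))

≥2⇒≢1 : ∀ {K} {a : Fin (suc (suc K))} → 2 ≤ toℕ a → a ≢ F.suc F.zero
≥2⇒≢1 (s≤s ()) refl

≥1⇒≢0 : ∀ {K} {a : Fin (suc K)} → 1 ≤ toℕ a → a ≢ F.zero
≥1⇒≢0 () refl

module ColouringOfMycielskian (G : Graph) (nb : ∀ x → ∃ (Adj G x)) {K}
         (c : Fin (n (Mycielskian G)) → Fin (suc (suc K)))
         (c-packing : IsPackingColoring (Mycielskian G) (suc (suc K)) c) where
  open MycielskianDistances G nb

  C : MV (n G) → Fin (suc (suc K))
  C v = c (E v)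

  Co Cc : Fin (n G) → Fin (suc (suc K))
  Co x = C (orig x)
  Cc x = C (copy x)

  one two : Fin (suc (suc K))
  one = F.zero
  two = F.suc F.zero

  clash : ∀ u v L → u ≢ v → C u ≡ C v → Within M L (E u) (E v) → L ≤ suc (toℕ (C u)) → ⊥
  clash u v L u≢v same walk L≤ =
    c-packing (E u) (E v) (u≢v ∘ encode-injective) same (Within-mono L≤ walk)

  restriction-packing : IsPackingColoring G (suc (suc K)) Co
  restriction-packing u v u≢v same walk =
    c-packing _ _ (u≢v ∘ orig-injective ∘ encode-injective) same (orig-orig walk)

  restrictionWithSpares : ∀ {a b} → a ≢ b → Unused Co a → Unused Co b → SpareColouring G (suc (suc K))
  restrictionWithSpares = spareColouring Co restriction-packing _ _

  hub≢copy : ∀ x → C hub ≢ Cc x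
  hub≢copy x same = clash hub (copy x) 1 (λ ()) same (hub-copy x) (s≤s z≤n)

  hub-unused : 1 ≤ toℕ (C hub) → Unused Co (C hub)
  hub-unused 1≤ x same = clash hub (orig x) 2 (λ ()) same (hub-orig x) (s≤s 1≤)

  copy-unused : ∀ x → 2 ≤ toℕ (Cc x) → Unused Co (Cc x)
  copy-unused x 2≤ y same = clash (copy x) (orig y) 3 (λ ()) same (copy-orig x y) (s≤s 2≤)

  sharedCopyColour : ∀ x y → x ≢ y → Cc x ≡ Cc y → Cc x ≡ one
  sharedCopyColour x y x≢y same with oneOrMore (Cc x)
  ... | inj₁ is-one = is-one
  ... | inj₂ 1≤ = ⊥-elim (clash (copy x) (copy y) 2 (x≢y ∘ copy-injective) same (copy-copy x y) (s≤s 1≤))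

  orig≢neighbourCopy : ∀ x z → Adj G x z → Co x ≢ Cc z
  orig≢neighbourCopy x z x~z same = clash (orig x) (copy z) 1 (λ ()) same (orig-copy x z x~z) (s≤s z≤n)

  ownCopyTwo : ∀ y → Cc y ≡ two → Co y ≢ two
  ownCopyTwo y y'-two y-two = clash (copy y) (orig y) 2 (λ ()) (trans y'-two (≡-sym y-two)) (copy-ownOrig y)
    (subst (λ a → 2 ≤ suc (toℕ a)) (≡-sym y'-two) ≤-refl)

  -- Case: w has colour 1.  Copies then avoid colour 1, so by
  -- 'sharedCopyColour' they have pairwise distinct colours.
  module HubColourOne (hub-one : C hub ≡ one) where

    copy≢one : ∀ x → Cc x ≢ one
    copy≢one x x'-one = hub≢copy x (trans hub-one (≡-sym x'-one))

    copyColours-distinct : ∀ x y → x ≢ y → Cc x ≢ Cc y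
    copyColours-distinct x y x≢y same = copy≢one x (sharedCopyColour x y x≢y same)

    -- If G has only the vertices p and q, where p' has colour 2 and q' a
    -- colour ≥ 3, then colour 2 is spare: p' is within 2 of p and adjacent to q.
    onlyTwoVertices : ∀ p q → (∀ x → x ≡ p ⊎ x ≡ q) → Cc p ≡ two → 2 ≤ toℕ (Cc q) →
                      SpareColouring G (suc (suc K))
    onlyTwoVertices p q cover p'-two q'-big =
      restrictionWithSpares (≥2⇒≢1 q'-big) (copy-unused q q'-big) two-unused
      where
      -- The neighbour of p is not p itself, hence it is q.
      q~p : Adj G q p
      q~p with nb p
      ... | z , p~z with cover z
      ...   | inj₁ refl = ⊥-elim (irrefl G p~z)
      ...   | inj₂ refl = Graph.sym G p~z
      two-unused : Unused Co two
      two-unused x same with cover x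
      ... | inj₁ refl = ownCopyTwo p p'-two (≡-sym same)
      ... | inj₂ refl = orig≢neighbourCopy q p q~p (trans (≡-sym same) (≡-sym p'-two))

    -- If p' has colour 2 and q' a colour ≥ 3, then either a third vertex r
    -- exists, and r' has another colour ≥ 3, or G = {p, q}.
    copyColouredTwo : ∀ p q → p ≢ q → Cc p ≡ two → 2 ≤ toℕ (Cc q) → SpareColouring G (suc (suc K))
    copyColouredTwo p q p≢q p'-two q'-big with any? (λ r → ¬? (r ≟ p) ×-dec ¬? (r ≟ q))
    ... | yes (r , r≢p , r≢q) with colourCases (Cc r)
    ...   | inj₁ r'-one = ⊥-elim (copy≢one r r'-one)
    ...   | inj₂ (inj₁ r'-two) = ⊥-elim (copyColours-distinct r p r≢p (trans r'-two (≡-sym p'-two)))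
    ...   | inj₂ (inj₂ r'-big) =
      restrictionWithSpares (copyColours-distinct q r (r≢q ∘ ≡-sym)) (copy-unused q q'-big) (copy-unused r r'-big)
    copyColouredTwo p q p≢q p'-two q'-big | no noThird = onlyTwoVertices p q cover p'-two q'-big
      where
      cover : ∀ x → x ≡ p ⊎ x ≡ q
      cover x with x ≟ p | x ≟ q
      ... | yes x≡p | _       = inj₁ x≡p
      ... | no _    | yes x≡q = inj₂ x≡q
      ... | no x≢p  | no x≢q  = ⊥-elim (noThird (x , x≢p , x≢q))

    spares : ∀ {p q} → p ≢ q → SpareColouring G (suc (suc K))
    spares {p} {q} p≢q with colourCases (Cc p) | colourCases (Cc q)
    ... | inj₁ p'-one | _ = ⊥-elim (copy≢one p p'-one)
    ... | _ | inj₁ q'-one = ⊥-elim (copy≢one q q'-one)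
    ... | inj₂ (inj₁ p'-two) | inj₂ (inj₁ q'-two) =
      ⊥-elim (copyColours-distinct p q p≢q (trans p'-two (≡-sym q'-two)))
    ... | inj₂ (inj₁ p'-two) | inj₂ (inj₂ q'-big) = copyColouredTwo p q p≢q p'-two q'-big
    ... | inj₂ (inj₂ p'-big) | inj₂ (inj₁ q'-two) = copyColouredTwo q p (p≢q ∘ ≡-sym) q'-two p'-big
    ... | inj₂ (inj₂ p'-big) | inj₂ (inj₂ q'-big) =
      restrictionWithSpares (copyColours-distinct p q p≢q) (copy-unused p p'-big) (copy-unused q q'-big)

  -- Case: w has a colour ≥ 2, which is then spare by 'hub-unused'.
  module HubColourAboveOne (hub-big : 1 ≤ toℕ (C hub)) where

    -- If y' is the only copy of colour 2 and all other copies have colour 1,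
    -- then w has a colour ≥ 3, and colours 1 and 2 can be merged on G:
    -- an original of colour 1 is not adjacent to y (y' is within 2 of y)
    -- nor to any other original v (v' has colour 1).
    singleCopyTwo : ∀ y → Cc y ≡ two → (∀ x → x ≢ y → Cc x ≡ one) → SpareColouring G (suc (suc K))
    singleCopyTwo y y'-two others-one with colourCases (C hub)
    ... | inj₁ hub-one = ⊥-elim (≥1⇒≢0 hub-big hub-one)
    ... | inj₂ (inj₁ hub-two) = ⊥-elim (hub≢copy y (trans hub-two (≡-sym y'-two)))
    ... | inj₂ (inj₂ hub-big′) =
      spareColouring (mergeOneTwo ∘ Co) (mergeOneTwo-packing G Co restriction-packing one-two-apart)
        (C hub) two (≥2⇒≢1 hub-big′)
        (mergeOneTwo-unused G Co hub-big′ (hub-unused hub-big)) (mergeOneTwo-unused-two G Co)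
      where
      one-two-apart : ∀ u v → Co u ≡ one → Co v ≡ two → ¬ Adj G u v
      one-two-apart u v u-one v-two u~v with v ≟ y
      ... | yes refl = ownCopyTwo v y'-two v-two
      ... | no v≢y   = orig≢neighbourCopy u v u~v (trans u-one (≡-sym (others-one v v≢y)))

    spares : SpareColouring G (suc (suc K))
    spares with any? (λ x → 2 ≤? toℕ (Cc x))
    ... | yes (x , x'-big) = restrictionWithSpares (hub≢copy x) (hub-unused hub-big) (copy-unused x x'-big)
    ... | no noBig with any? (λ x → Cc x ≟ two)
    ...   | yes (y , y'-two) = singleCopyTwo y y'-two others-one
      where
      others-one : ∀ x → x ≢ y → Cc x ≡ one
      others-one x x≢y with colourCases (Cc x)
      ... | inj₁ x'-one = x'-one
      ... | inj₂ (inj₁ x'-two) = sharedCopyColour x y x≢y (trans x'-two (≡-sym y'-two))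
      ... | inj₂ (inj₂ x'-big) = ⊥-elim (noBig (x , x'-big))
    ...   | no noTwo = restrictionWithSpares (≥1⇒≢0 hub-big) (hub-unused hub-big) one-unused
      where
      -- All copies have colour 1, and every original is adjacent to one.
      copy-one : ∀ x → Cc x ≡ one
      copy-one x with colourCases (Cc x)
      ... | inj₁ x'-one = x'-one
      ... | inj₂ (inj₁ x'-two) = ⊥-elim (noTwo (x , x'-two))
      ... | inj₂ (inj₂ x'-big) = ⊥-elim (noBig (x , x'-big))
      one-unused : Unused Co one
      one-unused x same with nb x
      ... | z , x~z = orig≢neighbourCopy x z x~z (trans (≡-sym same) (≡-sym (copy-one z)))

  spareColouringOfG : ∀ {p q : Fin (n G)} → p ≢ q → SpareColouring G (suc (suc K))
  spareColouringOfG p≢q with oneOrMore (C hub)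
  ... | inj₁ hub-one = HubColourOne.spares hub-one p≢q
  ... | inj₂ hub-big = HubColourAboveOne.spares hub-big

lowerBound : (G : Graph) (nb : ∀ x → ∃ (Adj G x)) {p q : Fin (n G)} → p ≢ q →
             ∀ {k k'} → (∀ m → HasPackingColoring G m → k ≤ m) →
             HasPackingColoring (Mycielskian G) k' → k + 2 ≤ k'
lowerBound G nb {p} p≢q {k' = zero} _ colouring with MycielskianDistances.twoColoursNeeded G nb p colouring
... | ()
lowerBound G nb {p} p≢q {k' = suc zero} _ colouring with MycielskianDistances.twoColoursNeeded G nb p colouring
... | s≤s ()
lowerBound G nb p≢q {k} {suc (suc K)} minimal (c , c-packing) = begin
  k + 2 ≤⟨ +-monoˡ-≤ 2 (minimal K (deleteSpareColours spares)) ⟩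
  K + 2 ≡⟨ +-comm K 2 ⟩
  suc (suc K) ∎
  where
  open ≤-Reasoning
  spares : SpareColouring G (suc (suc K))
  spares = ColouringOfMycielskian.spareColouringOfG G nb c c-packing p≢q

completeColour : ∀ {m k} → (Fin m → Fin k) → MV m → Fin (suc (suc k))
completeColour g (copy _) = F.zero
completeColour g hub      = F.suc F.zero
completeColour g (orig x) = F.suc (F.suc (g x))

-- For complete G this is a packing colouring: the copies form an
-- independent set, and two distinct originals are adjacent, so sharing a
-- colour would contradict g being a packing colouring.
module _ (G : Graph) (complete : Complete G) {k} (g : Fin (n G) → Fin k)
         (g-packing : IsPackingColoring G k g) where

  completeColour-packing : IsPackingColoring (Mycielskian G) (suc (suc k)) (completeColour g ∘ decode)
  completeColour-packing a b a≢b same walk with decode {n G} a in da | decode {n G} b in db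
  ... | orig x | orig y with x ≟ y
  ...   | yes refl = a≢b (decode-injective (trans da (≡-sym db)))
  ...   | no x≢y   = g-packing x y x≢y (suc-injective (suc-injective same))
                       (Within-mono (s≤s z≤n) (step (complete x y x≢y) here))
  completeColour-packing a b a≢b same walk | copy x | copy y = subst₂ (MAdj' G) da db (Within-1⇒Adj a≢b walk)
  completeColour-packing a b a≢b same walk | hub | hub = a≢b (decode-injective (trans da (≡-sym db)))
  completeColour-packing a b a≢b () walk | orig x | copy y
  completeColour-packing a b a≢b () walk | orig x | hub
  completeColour-packing a b a≢b () walk | copy x | orig y
  completeColour-packing a b a≢b () walk | copy x | hub
  completeColour-packing a b a≢b () walk | hub | orig y
  completeColour-packing a b a≢b () walk | hub | copy y

theorem2p4 : (G : Graph) → Connected G → 2 ≤ n G →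
    ∀ k k' → IsPackingChromaticNumber G k →
    IsPackingChromaticNumber (Mycielskian G) k' →
    (k + 2 ≤ k') × (Complete G → k' ≡ k + 2)
theorem2p4 G connected 2≤n k k' ((g , g-packing) , minimal) (colouringM , minimalM)
  with twoDistinct 2≤n
... | _ , _ , p≢q = lower , λ complete → ≤-antisym (minimalM (k + 2) (colouringOfSize complete)) lower
  where
  lower : k + 2 ≤ k'
  lower = lowerBound G (noIsolatedVertex connected p≢q) p≢q minimal colouringM
  colouringOfSize : Complete G → HasPackingColoring (Mycielskian G) (k + 2)
  colouringOfSize complete = subst (HasPackingColoring (Mycielskian G)) (+-comm 2 k)
    (completeColour g ∘ decode , completeColour-packing G complete g g-packing)
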